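{- Let $n\ge 1$ be an integer. If $\mathcal{F}\subseteq\mathbb{Z}_{2^n}$ does not contain a projective $2$-cube, then $|\mathcal{F}|\le |L_1|=2^{n-1}$.
   Context: $\mathbb{Z}_{2^n}$ is the cyclic group of integers modulo $2^n$. For $1\le i\le n$ the $i$-th layer is $L_i=\{x\in\mathbb{Z}_{2^n}: x\equiv 2^{i-1} \pmod{2^i}\}$ (so $L_1$ is the set of odd residues), and $L_{n+1}=\{0\}$. For a multiset $S=\{a_1,\dots,a_d\}$ of $d$ not necessarily distinct elements of $\mathbb{Z}_{2^n}$, the projective $d$-cube generated by $S$ is the set $\Sigma^*S=\{\sum_{i\in I}a_i \bmod 2^n : \emptyset\neq I\subseteq\{1,\dots,d\}\}$ (viewed as a set, so it may have fewer than $2^d-1$ elements). A set $A\subseteq\mathbb{Z}_{2^n}$ contains a projective $d$-cube if there is a multiset $S$ of size $d$ with $\Sigma^*S\subseteq A$. A projective $2$-cube is thus a set of the form $\{a,b,a+b\}$ (including the degenerate case $\{a,2a\}$). -}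

module Defs where

open import Data.Nat using (ℕ; zero; suc; _+_; _^_; _%_; NonZero)
open import Data.Nat.Properties using (m^n≢0)
open import Data.Nat.DivMod using (m%n<n)
open import Data.Fin using (Fin; toℕ; fromℕ<)
open import Data.Fin.Subset using (Subset; _∈_; Nonempty)
open import Data.Vec using (Vec; []; _∷_)
open import Data.Bool using (true; false)
open import Data.Product using (∃; _×_; Σ)
open import Relation.Binary.PropositionalEquality using (_≡_)

2^-nonZero : (n : ℕ) → NonZero (2 ^ n)
2^-nonZero n = m^n≢0 2 n

add : (n : ℕ) → Fin (2 ^ n) → Fin (2 ^ n) → Fin (2 ^ n)
add n x y = fromℕ< (m%n<n (toℕ x + toℕ y) (2 ^ n) {{2^-nonZero n}})

zeroZ : (n : ℕ) → Fin (2 ^ n)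
zeroZ n = fromℕ< (m%n<n 0 (2 ^ n) {{2^-nonZero n}})

-- Σ_{i ∈ I} a_i mod 2^n, for a multiset S = {a_1,…,a_d} given as a vector
-- (a_1,…,a_d) and an index set I ⊆ {1,…,d} given as a Subset d.
subsetSum : (n : ℕ) → ∀ {d} → Vec (Fin (2 ^ n)) d → Subset d → Fin (2 ^ n)
subsetSum n [] [] = zeroZ n
subsetSum n (a ∷ as) (true  ∷ I) = add n a (subsetSum n as I)
subsetSum n (a ∷ as) (false ∷ I) = subsetSum n as I

InProjCube : (n : ℕ) → ∀ {d} → Vec (Fin (2 ^ n)) d → Fin (2 ^ n) → Set
InProjCube n {d} S x = Σ (Subset d) λ I → Nonempty I × subsetSum n S I ≡ x

ProjCubeIn : (n : ℕ) → ∀ {d} → Vec (Fin (2 ^ n)) d → Subset (2 ^ n) → Set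
ProjCubeIn n S A = ∀ x → InProjCube n S x → x ∈ A

ContainsProjCube : (n d : ℕ) → Subset (2 ^ n) → Set
ContainsProjCube n d A = ∃ λ (S : Vec (Fin (2 ^ n)) d) → ProjCubeIn n S A

module Submission where

-- Idea: if F is empty there is nothing to prove.  Otherwise fix a ∈ F.  For
-- every x ∈ F the element x - a cannot lie in F, since then a, x - a and
-- a + (x - a) = x would form a projective 2-cube inside F.  Hence F and its
-- translate F + a = { x : x - a ∈ F } are disjoint; translation is a bijection
-- of ℤ_{2^n}, so both have |F| elements, and 2|F| ≤ 2^n.

open import Defs
open import Data.Nat using (ℕ; _≤_; _^_; _∸_)
open import Data.Fin.Subset using (Subset; ∣_∣)
open import Relation.Nullary using (¬_; yes; no)

open import Data.Nat using (suc; _+_; _*_; _%_; NonZero; >-nonZero⁻¹; z≤n)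
import Data.Nat.Properties as ℕ
open import Data.Nat.DivMod using (m%n<n; m<n⇒m%n≡m; %-distribˡ-+; m%n%n≡m%n; n%n≡0)
open import Data.Fin using (Fin; toℕ; fromℕ<; zero; suc)
open import Data.Fin.Properties using (toℕ-fromℕ<; toℕ-injective; toℕ<n)
open import Data.Fin.Subset using (_∈_; _∉_; _⊆_; ∁; inside)
open import Data.Fin.Subset.Properties
  using (p⊆q⇒∣p∣≤∣q∣; ∣∁p∣≡n∸∣p∣; ∣p∣≤n; x∉p⇒x∈∁p; nonempty?; Empty-unique; ∣⊥∣≡0)
open import Data.Fin.Permutation using (Permutation′; permutation; _⟨$⟩ʳ_)
open import Data.Vec using ([]; _∷_; lookup; tabulate; there)
open import Data.Vec.Properties using ([]=⇒lookup; lookup⇒[]=; lookup∘tabulate)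
open import Data.Bool using (Bool; true; false)
open import Data.Product using (_,_)
open import Function using (_∘_)
open import Relation.Binary.PropositionalEquality
open import Algebra.Properties.CommutativeMonoid.Sum ℕ.+-0-commutativeMonoid
  using (sum; sum-permute; sum-cong-≗)

indicator : Bool → ℕ
indicator true  = 1
indicator false = 0

∣p∣≡sum : ∀ {m} (p : Subset m) → ∣ p ∣ ≡ sum (indicator ∘ lookup p)
∣p∣≡sum []          = refl
∣p∣≡sum (true  ∷ p) = cong suc (∣p∣≡sum p)
∣p∣≡sum (false ∷ p) = ∣p∣≡sum p

preimage : ∀ {m} → (Fin m → Fin m) → Subset m → Subset m
preimage f p = tabulate (lookup p ∘ f)

∈-preimage : ∀ {m} (f : Fin m → Fin m) (p : Subset m) {x} →
             x ∈ preimage f p → f x ∈ p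
∈-preimage f p {x} x∈ = lookup⇒[]= (f x) p (begin
    lookup p (f x)             ≡⟨ lookup∘tabulate (lookup p ∘ f) x ⟨
    lookup (preimage f p) x    ≡⟨ []=⇒lookup x∈ ⟩
    inside                     ∎)
  where open ≡-Reasoning

∣preimage∣ : ∀ {m} (π : Permutation′ m) (p : Subset m) →
             ∣ preimage (π ⟨$⟩ʳ_) p ∣ ≡ ∣ p ∣
∣preimage∣ π p = begin
    ∣ preimage (π ⟨$⟩ʳ_) p ∣                   ≡⟨ ∣p∣≡sum (preimage (π ⟨$⟩ʳ_) p) ⟩
    sum (indicator ∘ lookup (preimage (π ⟨$⟩ʳ_) p))
      ≡⟨ sum-cong-≗ (cong indicator ∘ lookup∘tabulate (lookup p ∘ (π ⟨$⟩ʳ_))) ⟩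
    sum (indicator ∘ lookup p ∘ (π ⟨$⟩ʳ_))    ≡⟨ sum-permute (indicator ∘ lookup p) π ⟨
    sum (indicator ∘ lookup p)                ≡⟨ ∣p∣≡sum p ⟨
    ∣ p ∣                                     ∎
  where open ≡-Reasoning

-- Disjoint subsets of Fin m have at most m elements together
-- (q lies in the complement of p, which has m - |p| elements).
disjoint-size : ∀ {m} (p q : Subset m) → (∀ {x} → x ∈ q → x ∉ p) →
                ∣ q ∣ + ∣ p ∣ ≤ m
disjoint-size {m} p q disjoint = ℕ.m≤o∸n⇒m+n≤o ∣ q ∣ (∣p∣≤n p)
  (subst (∣ q ∣ ≤_) (∣∁p∣≡n∸∣p∣ p) (p⊆q⇒∣p∣≤∣q∣ q⊆∁p))
  where
    q⊆∁p : q ⊆ ∁ p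
    q⊆∁p x∈q = x∉p⇒x∈∁p (disjoint x∈q)

module Cyclic (N : ℕ) {{_ : NonZero N}} where

  infixl 6 _⊕_

  _⊕_ : Fin N → Fin N → Fin N
  x ⊕ y = fromℕ< (m%n<n (toℕ x + toℕ y) N)

  𝟘 : Fin N
  𝟘 = fromℕ< (m%n<n 0 N)

  ⊖_ : Fin N → Fin N
  ⊖ x = fromℕ< (m%n<n (N ∸ toℕ x) N)

  toℕ-⊕ : ∀ x y → toℕ (x ⊕ y) ≡ (toℕ x + toℕ y) % N
  toℕ-⊕ x y = toℕ-fromℕ< _

  toℕ-𝟘 : toℕ 𝟘 ≡ 0
  toℕ-𝟘 = trans (toℕ-fromℕ< _) (m<n⇒m%n≡m (>-nonZero⁻¹ N))

  [m%N+k]%N : ∀ m k → (m % N + k) % N ≡ (m + k) % N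
  [m%N+k]%N m k = begin
      (m % N + k) % N             ≡⟨ %-distribˡ-+ (m % N) k N ⟩
      (m % N % N + k % N) % N     ≡⟨ cong (λ t → (t + k % N) % N) (m%n%n≡m%n m N) ⟩
      (m % N + k % N) % N         ≡⟨ %-distribˡ-+ m k N ⟨
      (m + k) % N                 ∎
    where open ≡-Reasoning

  [m+k%N]%N : ∀ m k → (m + k % N) % N ≡ (m + k) % N
  [m+k%N]%N m k = begin
      (m + k % N) % N   ≡⟨ cong (_% N) (ℕ.+-comm m (k % N)) ⟩
      (k % N + m) % N   ≡⟨ [m%N+k]%N k m ⟩
      (k + m) % N       ≡⟨ cong (_% N) (ℕ.+-comm k m) ⟩
      (m + k) % N       ∎
    where open ≡-Reasoning

  ⊕-comm : ∀ x y → x ⊕ y ≡ y ⊕ x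
  ⊕-comm x y = toℕ-injective (begin
      toℕ (x ⊕ y)             ≡⟨ toℕ-⊕ x y ⟩
      (toℕ x + toℕ y) % N     ≡⟨ cong (_% N) (ℕ.+-comm (toℕ x) (toℕ y)) ⟩
      (toℕ y + toℕ x) % N     ≡⟨ toℕ-⊕ y x ⟨
      toℕ (y ⊕ x)             ∎)
    where open ≡-Reasoning

  ⊕-assoc : ∀ x y z → x ⊕ y ⊕ z ≡ x ⊕ (y ⊕ z)
  ⊕-assoc x y z = toℕ-injective (begin
      toℕ (x ⊕ y ⊕ z)                     ≡⟨ toℕ-⊕ (x ⊕ y) z ⟩
      (toℕ (x ⊕ y) + toℕ z) % N           ≡⟨ cong (λ t → (t + toℕ z) % N) (toℕ-⊕ x y) ⟩
      ((toℕ x + toℕ y) % N + toℕ z) % N   ≡⟨ [m%N+k]%N (toℕ x + toℕ y) (toℕ z) ⟩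
      (toℕ x + toℕ y + toℕ z) % N         ≡⟨ cong (_% N) (ℕ.+-assoc (toℕ x) (toℕ y) (toℕ z)) ⟩
      (toℕ x + (toℕ y + toℕ z)) % N       ≡⟨ [m+k%N]%N (toℕ x) (toℕ y + toℕ z) ⟨
      (toℕ x + (toℕ y + toℕ z) % N) % N   ≡⟨ cong (λ t → (toℕ x + t) % N) (toℕ-⊕ y z) ⟨
      (toℕ x + toℕ (y ⊕ z)) % N           ≡⟨ toℕ-⊕ x (y ⊕ z) ⟨
      toℕ (x ⊕ (y ⊕ z))                   ∎)
    where open ≡-Reasoning

  ⊕-identityʳ : ∀ x → x ⊕ 𝟘 ≡ x
  ⊕-identityʳ x = toℕ-injective (begin
      toℕ (x ⊕ 𝟘)             ≡⟨ toℕ-⊕ x 𝟘 ⟩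
      (toℕ x + toℕ 𝟘) % N     ≡⟨ cong (λ t → (toℕ x + t) % N) toℕ-𝟘 ⟩
      (toℕ x + 0) % N         ≡⟨ cong (_% N) (ℕ.+-identityʳ (toℕ x)) ⟩
      toℕ x % N               ≡⟨ m<n⇒m%n≡m (toℕ<n x) ⟩
      toℕ x                   ∎)
    where open ≡-Reasoning

  ⊕-inverseˡ : ∀ x → ⊖ x ⊕ x ≡ 𝟘
  ⊕-inverseˡ x = toℕ-injective (begin
      toℕ (⊖ x ⊕ x)                     ≡⟨ toℕ-⊕ (⊖ x) x ⟩
      (toℕ (⊖ x) + toℕ x) % N           ≡⟨ cong (λ t → (t + toℕ x) % N) (toℕ-fromℕ< _) ⟩
      ((N ∸ toℕ x) % N + toℕ x) % N     ≡⟨ [m%N+k]%N (N ∸ toℕ x) (toℕ x) ⟩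
      (N ∸ toℕ x + toℕ x) % N           ≡⟨ cong (_% N) (ℕ.m∸n+n≡m (ℕ.<⇒≤ (toℕ<n x))) ⟩
      N % N                             ≡⟨ n%n≡0 N ⟩
      0                                 ≡⟨ toℕ-𝟘 ⟨
      toℕ 𝟘                             ∎)
    where open ≡-Reasoning

  ⊕-inverseʳ : ∀ x → x ⊕ ⊖ x ≡ 𝟘
  ⊕-inverseʳ x = trans (⊕-comm x (⊖ x)) (⊕-inverseˡ x)

  ⊖-⊕-cancel : ∀ a x → x ⊕ ⊖ a ⊕ a ≡ x
  ⊖-⊕-cancel a x = begin
      x ⊕ ⊖ a ⊕ a       ≡⟨ ⊕-assoc x (⊖ a) a ⟩
      x ⊕ (⊖ a ⊕ a)     ≡⟨ cong (x ⊕_) (⊕-inverseˡ a) ⟩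
      x ⊕ 𝟘             ≡⟨ ⊕-identityʳ x ⟩
      x                 ∎
    where open ≡-Reasoning

  ⊕-⊖-cancel : ∀ a x → x ⊕ a ⊕ ⊖ a ≡ x
  ⊕-⊖-cancel a x = begin
      x ⊕ a ⊕ ⊖ a       ≡⟨ ⊕-assoc x a (⊖ a) ⟩
      x ⊕ (a ⊕ ⊖ a)     ≡⟨ cong (x ⊕_) (⊕-inverseʳ a) ⟩
      x ⊕ 𝟘             ≡⟨ ⊕-identityʳ x ⟩
      x                 ∎
    where open ≡-Reasoning

  translation : Fin N → Permutation′ N
  translation a = permutation (_⊕ ⊖ a) (_⊕ a) (⊕-⊖-cancel a) (⊖-⊕-cancel a)

  -- Halving lemma: if F is disjoint from its translate F + a, then
  -- 2|F| ≤ N, because F + a = { x : x - a ∈ F } has |F| elements.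
  halving : (F : Subset N) (a : Fin N) →
            (∀ {x} → x ∈ F → x ⊕ ⊖ a ∉ F) →
            ∣ F ∣ + ∣ F ∣ ≤ N
  halving F a disjoint = subst (λ k → k + ∣ F ∣ ≤ N) (∣preimage∣ (translation a) F)
    (disjoint-size F (preimage (_⊕ ⊖ a) F)
      (λ x∈F+a x∈F → disjoint x∈F (∈-preimage (_⊕ ⊖ a) F x∈F+a)))

-- 3. The theorem: ℤ_{2^n} with the addition of Defs is the group ℤ_N of
-- part 2 for N = 2^n (the two additions coincide by definition).

module PowerOfTwo (n : ℕ) where

  open Cyclic (2 ^ n) {{2^-nonZero n}}

  cube : (F : Subset (2 ^ n)) {a b : Fin (2 ^ n)} →
         a ∈ F → b ∈ F → a ⊕ b ∈ F → ContainsProjCube n 2 F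
  cube F {a} {b} a∈F b∈F a+b∈F = (a ∷ b ∷ []) , sums∈F
    where
      sums∈F : ProjCubeIn n (a ∷ b ∷ []) F
      sums∈F _ ((true  ∷ true  ∷ []) , _ , refl) =
        subst (_∈ F) (cong (a ⊕_) (sym (⊕-identityʳ b))) a+b∈F
      sums∈F _ ((true  ∷ false ∷ []) , _ , refl) = subst (_∈ F) (sym (⊕-identityʳ a)) a∈F
      sums∈F _ ((false ∷ true  ∷ []) , _ , refl) = subst (_∈ F) (sym (⊕-identityʳ b)) b∈F
      sums∈F _ ((false ∷ false ∷ []) , (zero , ()) , _)
      sums∈F _ ((false ∷ false ∷ []) , (suc zero , there ()) , _)

  -- A cube-free F is disjoint from its translate by any a ∈ F:
  -- x ∈ F and x - a ∈ F would give the cube {a, x - a, x}.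
  cube-free-halving : (F : Subset (2 ^ n)) → ¬ ContainsProjCube n 2 F →
                      ∣ F ∣ + ∣ F ∣ ≤ 2 ^ n
  cube-free-halving F noCube with nonempty? F
  ... | yes (a , a∈F) = halving F a λ {x} x∈F x-a∈F →
          noCube (cube F a∈F x-a∈F (subst (_∈ F) (sym (a⊕[x⊖a]≡x x)) x∈F))
    where
      a⊕[x⊖a]≡x : ∀ x → a ⊕ (x ⊕ ⊖ a) ≡ x
      a⊕[x⊖a]≡x x = trans (⊕-comm a (x ⊕ ⊖ a)) (⊖-⊕-cancel a x)
  ... | no empty = subst (λ k → k + k ≤ 2 ^ n) (sym ∣F∣≡0) z≤n
    where
      ∣F∣≡0 : ∣ F ∣ ≡ 0
      ∣F∣≡0 = trans (cong ∣_∣ (Empty-unique empty)) (∣⊥∣≡0 (2 ^ n))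

-- Since 2^n = 2 · 2^(n-1) for n ≥ 1, the bound 2|F| ≤ 2^n halves.
proposition1p5 : (n : ℕ) → 1 ≤ n → (F : Subset (2 ^ n)) →
    ¬ ContainsProjCube n 2 F → ∣ F ∣ ≤ 2 ^ (n ∸ 1)
proposition1p5 (suc k) _ F noCube = ℕ.*-cancelˡ-≤ 2 2∣F∣≤2^[k+1]
  where
    2∣F∣≤2^[k+1] : 2 * ∣ F ∣ ≤ 2 ^ suc k
    2∣F∣≤2^[k+1] = subst (_≤ 2 ^ suc k) (cong (∣ F ∣ +_) (sym (ℕ.+-identityʳ ∣ F ∣)))
                     (PowerOfTwo.cube-free-halving (suc k) F noCube)
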